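{- For integers $i\ge0$, $j\ge0$ and real $k$: (a) $b_{i,j+1,k}=\sum_{r=0}^{i-1}\binom{i}{r}b_{r,j,k}$; (b) $b_{i,j,k+1}=\sum_{r=0}^{i}\binom{i}{r}b_{r,j,k}$; (c) $b_{i+1,j+1,k}=(j+1)\sum_{r=0}^{i}\binom{i}{r}b_{r,j,k}+k\,b_{i,j+1,k}$; (d) $b_{i+1,j+1,k}=(j+1)\sum_{r=j}^{i}b_{r,j,k}\,(j+k+1)^{i-r}$; (e) $b_{i+1,j+1,k}=(j+1)\sum_{r=j}^{i}b_{r,j,k+1}\,k^{i-r}$.
   Context: For integers $i\ge0$, $j\ge0$ and real $k$, $b_{i,j,k}=\sum_{r=0}^{j}\binom{j}{r}(-1)^{j-r}(r+k)^i$, with the convention $0^0=1$; empty sums are $0$. -}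

module Defs where

open import Level using (Level)
open import Data.Nat as ℕ using (ℕ; zero; suc; _∸_)
open import Data.Nat.Combinatorics using (_C_)
open import Algebra.Bundles using (CommutativeRing; Semiring)
import Algebra.Definitions.RawSemiring as RawSemiringDefs

-- Definitions over an arbitrary commutative ring R (the paper's k is real;
-- the identities are integer-polynomial identities in k).
module BNum {c ℓ : Level} (R : CommutativeRing c ℓ) where
  open CommutativeRing R
  open RawSemiringDefs (Semiring.rawSemiring semiring) public using (_×_; _^_)

  nat : ℕ → Carrier
  nat n = n × 1#

  sumBelow : ℕ → (ℕ → Carrier) → Carrier
  sumBelow zero    f = 0#
  sumBelow (suc n) f = sumBelow n f + f n

  -- Σ_{r=a}^{b} f r  (empty, i.e. 0, when b < a)
  sumFromTo : ℕ → ℕ → (ℕ → Carrier) → Carrier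
  sumFromTo a b f = sumBelow (suc b ∸ a) (λ t → f (a ℕ.+ t))

  -- b_{i,j,k} = Σ_{r=0}^{j} C(j,r) (-1)^{j-r} (r+k)^i   (x^0 = 1, so 0^0 = 1)
  b : ℕ → ℕ → Carrier → Carrier
  b i j k = sumFromTo 0 j (λ r → (j C r) × ((- 1#) ^ (j ∸ r) * ((nat r + k) ^ i)))

module Submission where

-- b_{i,j,k} is the j-th forward difference of x ↦ x^i at k.  Pascal's rule turns this into
-- b_{i,j+1,k} = b_{i,j,k+1} - b_{i,j,k}, and expanding (r+k+1)^i binomially gives (b) and hence (a).
-- Writing (r+k)^{i+1} = k (r+k)^i + r (r+k)^i and using r C(j+1,r) = (j+1) C(j,r-1)
-- gives b_{i+1,j+1,k} = k b_{i,j+1,k} + (j+1) b_{i,j,k+1}, hence (c).  Read as first-order linear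
-- recurrences in i starting from b_{0,j+1,k} = 0, this and its variant with b_{i,j,k+1} =
-- b_{i,j+1,k} + b_{i,j,k} unroll to (e) and (d); the sums start at r = j since b_{r,j,k} = 0 for
-- r < j, by (a) and induction on j.

open import Defs
open import Level using (Level)
open import Algebra.Bundles using (CommutativeRing)
open import Data.Nat as ℕ using (ℕ; zero; suc; _∸_; _<_; s≤s; s≤s⁻¹; _≤?_)
import Data.Nat.Properties as ℕ
open import Data.Nat.Combinatorics using (_C_; nCn≡1; nC1≡n; nCk+nC[k+1]≡[n+1]C[k+1])
open import Data.Nat.Combinatorics.Specification using (k>n⇒nCk≡0)
open import Data.Nat.Solver using (module +-*-Solver)
open import Data.Product using (_,_) renaming (_×_ to _∧_)
open import Relation.Nullary using (yes; no)
open import Relation.Binary.PropositionalEquality as ≡ using (_≡_)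

[1+k]*[1+n]C[1+k]≡[1+n]*nCk : ∀ n k → suc k ℕ.* (suc n C suc k) ≡ suc n ℕ.* (n C k)
[1+k]*[1+n]C[1+k]≡[1+n]*nCk zero    zero    = ≡.refl
[1+k]*[1+n]C[1+k]≡[1+n]*nCk zero    (suc k) = ℕ.*-zeroʳ (suc (suc k))
[1+k]*[1+n]C[1+k]≡[1+n]*nCk (suc n) zero    =
  ≡.trans (ℕ.+-identityʳ _) (≡.trans (nC1≡n (suc (suc n))) (≡.sym (ℕ.*-identityʳ _)))
[1+k]*[1+n]C[1+k]≡[1+n]*nCk (suc n) (suc k) = begin
  suc (suc k) ℕ.* (suc (suc n) C suc (suc k))
    ≡⟨ ≡.cong (suc (suc k) ℕ.*_) (≡.sym (nCk+nC[k+1]≡[n+1]C[k+1] (suc n) (suc k))) ⟩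
  suc (suc k) ℕ.* (suc n C suc k ℕ.+ suc n C suc (suc k))
    ≡⟨ rearrange k (suc n C suc k) (suc n C suc (suc k)) ⟩
  suc k ℕ.* (suc n C suc k) ℕ.+ suc (suc k) ℕ.* (suc n C suc (suc k)) ℕ.+ suc n C suc k
    ≡⟨ ≡.cong₂ (λ u v → u ℕ.+ v ℕ.+ suc n C suc k)
         ([1+k]*[1+n]C[1+k]≡[1+n]*nCk n k) ([1+k]*[1+n]C[1+k]≡[1+n]*nCk n (suc k)) ⟩
  suc n ℕ.* (n C k) ℕ.+ suc n ℕ.* (n C suc k) ℕ.+ suc n C suc k
    ≡⟨ ≡.cong (suc n ℕ.* (n C k) ℕ.+ suc n ℕ.* (n C suc k) ℕ.+_) (≡.sym (nCk+nC[k+1]≡[n+1]C[k+1] n k)) ⟩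
  suc n ℕ.* (n C k) ℕ.+ suc n ℕ.* (n C suc k) ℕ.+ (n C k ℕ.+ n C suc k)
    ≡⟨ collect n (n C k) (n C suc k) ⟩
  suc (suc n) ℕ.* (n C k ℕ.+ n C suc k)
    ≡⟨ ≡.cong (suc (suc n) ℕ.*_) (nCk+nC[k+1]≡[n+1]C[k+1] n k) ⟩
  suc (suc n) ℕ.* (suc n C suc k)
    ∎
  where
  open ≡.≡-Reasoning
  open +-*-Solver
  rearrange : ∀ k x y → suc (suc k) ℕ.* (x ℕ.+ y) ≡ suc k ℕ.* x ℕ.+ suc (suc k) ℕ.* y ℕ.+ x
  rearrange = solve 3 (λ k x y → (con 2 :+ k) :* (x :+ y) := (con 1 :+ k) :* x :+ (con 2 :+ k) :* y :+ x) ≡.refl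
  collect : ∀ n x y → suc n ℕ.* x ℕ.+ suc n ℕ.* y ℕ.+ (x ℕ.+ y) ≡ suc (suc n) ℕ.* (x ℕ.+ y)
  collect = solve 3 (λ n x y → (con 1 :+ n) :* x :+ (con 1 :+ n) :* y :+ (x :+ y) := (con 2 :+ n) :* (x :+ y)) ≡.refl

module ForwardDifferences {c ℓ : Level} (R : CommutativeRing c ℓ) where
  open CommutativeRing R
  open BNum R
  open import Algebra.Properties.Semiring.Mult semiring
    using (×-congʳ; ×-homo-1; ×-homo-+; ×-assocˡ; ×-assoc-*; ×-comm-*)
  open import Algebra.Properties.CommutativeMonoid.Mult +-commutativeMonoid using (×-distrib-+)
  open import Algebra.Properties.Semiring.Exp semiring using (^-congˡ; ^-congʳ)
  open import Algebra.Properties.Ring ring using (-1*x≈-x; -‿distribˡ-*; -‿distribʳ-*; -0#≈0#; -‿+-comm)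
  open import Algebra.Solver.Ring.NaturalCoefficients.Default commutativeSemiring
    using (solve; con; _:+_; _:*_; _:=_)
  open import Relation.Binary.Reasoning.Setoid setoid

  ×≈nat* : ∀ n x → n × x ≈ nat n * x
  ×≈nat* n x = trans (×-congʳ n (sym (*-identityˡ x))) (sym (×-assoc-* n 1# x))

  ×-zeroʳ : ∀ n → n × 0# ≈ 0#
  ×-zeroʳ n = trans (×≈nat* n 0#) (zeroʳ (nat n))

  sumBelow-cong : ∀ n {f g : ℕ → Carrier} → (∀ r → r < n → f r ≈ g r) → sumBelow n f ≈ sumBelow n g
  sumBelow-cong zero    f≈g = refl
  sumBelow-cong (suc n) f≈g = +-cong (sumBelow-cong n (λ r r<n → f≈g r (ℕ.m<n⇒m<1+n r<n))) (f≈g n (ℕ.n<1+n n))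

  sumBelow-zero : ∀ n {f : ℕ → Carrier} → (∀ r → r < n → f r ≈ 0#) → sumBelow n f ≈ 0#
  sumBelow-zero n f≈0 = trans (sumBelow-cong n f≈0) (sumBelow-const0 n)
    where
    sumBelow-const0 : ∀ n → sumBelow n (λ _ → 0#) ≈ 0#
    sumBelow-const0 zero    = refl
    sumBelow-const0 (suc n) = trans (+-identityʳ _) (sumBelow-const0 n)

  sumBelow-+ : ∀ n (f g : ℕ → Carrier) → sumBelow n (λ r → f r + g r) ≈ sumBelow n f + sumBelow n g
  sumBelow-+ zero    f g = sym (+-identityˡ 0#)
  sumBelow-+ (suc n) f g = trans (+-congʳ (sumBelow-+ n f g))
    (solve 4 (λ a b c d → (a :+ b) :+ (c :+ d) := (a :+ c) :+ (b :+ d)) refl _ _ _ _)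

  *-distribˡ-sumBelow : ∀ n x (f : ℕ → Carrier) → x * sumBelow n f ≈ sumBelow n (λ r → x * f r)
  *-distribˡ-sumBelow zero    x f = zeroʳ x
  *-distribˡ-sumBelow (suc n) x f = trans (distribˡ x _ _) (+-congʳ (*-distribˡ-sumBelow n x f))

  ×-distribˡ-sumBelow : ∀ m n (f : ℕ → Carrier) → m × sumBelow n f ≈ sumBelow n (λ r → m × f r)
  ×-distribˡ-sumBelow m zero    f = ×-zeroʳ m
  ×-distribˡ-sumBelow m (suc n) f = trans (×-distrib-+ _ _ m) (+-congʳ (×-distribˡ-sumBelow m n f))

  -‿distrib-sumBelow : ∀ n (f : ℕ → Carrier) → - sumBelow n f ≈ sumBelow n (λ r → - f r)
  -‿distrib-sumBelow zero    f = -0#≈0#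
  -‿distrib-sumBelow (suc n) f = trans (sym (-‿+-comm _ _)) (+-congʳ (-‿distrib-sumBelow n f))

  sumBelow-head : ∀ n (f : ℕ → Carrier) → sumBelow (suc n) f ≈ f 0 + sumBelow n (λ r → f (suc r))
  sumBelow-head zero    f = +-comm 0# (f 0)
  sumBelow-head (suc n) f = trans (+-congʳ (sumBelow-head n f)) (+-assoc _ _ _)

  sumBelow-comm : ∀ n m (F : ℕ → ℕ → Carrier) →
    sumBelow n (λ a → sumBelow m (F a)) ≈ sumBelow m (λ d → sumBelow n (λ a → F a d))
  sumBelow-comm zero    m F = sym (sumBelow-zero m (λ _ _ → refl))
  sumBelow-comm (suc n) m F = trans (+-congʳ (sumBelow-comm n m F)) (sym (sumBelow-+ m _ _))

  sumBelow-≡ : ∀ {m n} (f : ℕ → Carrier) → m ≡ n → sumBelow m f ≈ sumBelow n f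
  sumBelow-≡ f ≡.refl = refl

  sumBelow-skip : ∀ j t (f : ℕ → Carrier) → (∀ r → r < j → f r ≈ 0#) →
    sumBelow (j ℕ.+ t) f ≈ sumBelow t (λ u → f (j ℕ.+ u))
  sumBelow-skip j zero    f f≈0 = trans (sumBelow-≡ f (ℕ.+-identityʳ j)) (sumBelow-zero j f≈0)
  sumBelow-skip j (suc t) f f≈0 = trans (sumBelow-≡ f (ℕ.+-suc j t)) (+-congʳ (sumBelow-skip j t f f≈0))

  sumBelow≈sumFromTo : ∀ j i (f : ℕ → Carrier) → (∀ r → r < j → f r ≈ 0#) →
    sumBelow (suc i) f ≈ sumFromTo j i f
  sumBelow≈sumFromTo j i f f≈0 with j ≤? suc i
  ... | yes j≤1+i = trans (sumBelow-≡ f (≡.sym (ℕ.m+[n∸m]≡n j≤1+i))) (sumBelow-skip j (suc i ∸ j) f f≈0)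
  ... | no  j≰1+i = trans (sumBelow-zero (suc i) (λ r r<1+i → f≈0 r (ℕ.<-trans r<1+i 1+i<j)))
                          (sumBelow-≡ _ (≡.sym (ℕ.m≤n⇒m∸n≡0 (ℕ.<⇒≤ 1+i<j))))
    where 1+i<j = ℕ.≰⇒> j≰1+i

  sumBelow-pascal : ∀ n (g : ℕ → Carrier) →
    sumBelow (suc (suc n)) (λ t → (suc n C t) × g t)
      ≈ sumBelow (suc n) (λ s → (n C s) × g (suc s)) + sumBelow (suc n) (λ t → (n C t) × g t)
  sumBelow-pascal n g = begin
    sumBelow (suc (suc n)) (λ t → (suc n C t) × g t)
      ≈⟨ sumBelow-head (suc n) _ ⟩
    X + sumBelow (suc n) (λ s → (suc n C suc s) × g (suc s))
      ≈⟨ +-congˡ (sumBelow-cong (suc n) (λ s _ → split s)) ⟩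
    X + sumBelow (suc n) (λ s → (n C s) × g (suc s) + (n C suc s) × g (suc s))
      ≈⟨ +-congˡ (sumBelow-+ (suc n) _ _) ⟩
    X + (A + (B + (n C suc n) × g (suc n)))
      ≈⟨ +-congˡ (+-congˡ (+-congˡ (reflexive (≡.cong (_× g (suc n)) (k>n⇒nCk≡0 (ℕ.n<1+n n)))))) ⟩
    X + (A + (B + 0#))
      ≈⟨ solve 3 (λ x a c → x :+ (a :+ (c :+ con 0)) := a :+ (x :+ c)) refl X A B ⟩
    A + (X + B)
      ≈⟨ +-congˡ (sym (sumBelow-head n (λ t → (n C t) × g t))) ⟩
    A + sumBelow (suc n) (λ t → (n C t) × g t)
      ∎
    where
    X = (n C 0) × g 0
    A = sumBelow (suc n) (λ s → (n C s) × g (suc s))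
    B = sumBelow n (λ s → (n C suc s) × g (suc s))
    split : ∀ s → (suc n C suc s) × g (suc s) ≈ (n C s) × g (suc s) + (n C suc s) × g (suc s)
    split s = trans (reflexive (≡.cong (_× g (suc s)) (≡.sym (nCk+nC[k+1]≡[n+1]C[k+1] n s))))
                    (×-homo-+ (g (suc s)) (n C s) (n C suc s))

  binomial-expansion : ∀ i x → (x + 1#) ^ i ≈ sumBelow (suc i) (λ r → (i C r) × x ^ r)
  binomial-expansion zero    x = sym (trans (+-identityˡ _) (+-identityʳ 1#))
  binomial-expansion (suc i) x = begin
    (x + 1#) * (x + 1#) ^ i
      ≈⟨ *-congˡ (binomial-expansion i x) ⟩
    (x + 1#) * S
      ≈⟨ distribʳ S x 1# ⟩
    x * S + 1# * S
      ≈⟨ +-cong (*-distribˡ-sumBelow (suc i) x _) (*-identityˡ S) ⟩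
    sumBelow (suc i) (λ r → x * ((i C r) × x ^ r)) + S
      ≈⟨ +-congʳ (sumBelow-cong (suc i) (λ r _ → ×-comm-* (i C r) x (x ^ r))) ⟩
    sumBelow (suc i) (λ r → (i C r) × (x * x ^ r)) + S
      ≈⟨ sumBelow-pascal i (x ^_) ⟨
    sumBelow (suc (suc i)) (λ r → (suc i C r) × x ^ r)
      ∎
    where S = sumBelow (suc i) (λ r → (i C r) × x ^ r)

  sumBelow-weighted-powers-suc : ∀ x (g : ℕ → Carrier) i →
    sumBelow (suc (suc i)) (λ r → g r * x ^ (suc i ∸ r))
      ≈ x * sumBelow (suc i) (λ r → g r * x ^ (i ∸ r)) + g (suc i)
  sumBelow-weighted-powers-suc x g i =
    +-cong (sym (trans (*-distribˡ-sumBelow (suc i) x _) (sumBelow-cong (suc i) step)))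
           (trans (*-congˡ (^-congʳ x (ℕ.n∸n≡0 i))) (*-identityʳ _))
    where
    step : ∀ r → r < suc i → x * (g r * x ^ (i ∸ r)) ≈ g r * x ^ (suc i ∸ r)
    step r (s≤s r≤i) = trans (solve 3 (λ x g p → x :* (g :* p) := g :* (x :* p)) refl x (g r) (x ^ (i ∸ r)))
                             (*-congˡ (^-congʳ x (≡.sym (ℕ.+-∸-assoc 1 r≤i))))

  linear-recurrence-solution : ∀ x m (g B : ℕ → Carrier) → B 0 ≈ 0# →
    (∀ i → B (suc i) ≈ x * B i + m × g i) →
    ∀ i → B (suc i) ≈ m × sumBelow (suc i) (λ r → g r * x ^ (i ∸ r))
  linear-recurrence-solution x m g B B₀≈0 rec zero = begin
    B 1                   ≈⟨ rec 0 ⟩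
    x * B 0 + m × g 0     ≈⟨ +-congʳ (trans (*-congˡ B₀≈0) (zeroʳ x)) ⟩
    0# + m × g 0          ≈⟨ +-identityˡ _ ⟩
    m × g 0               ≈⟨ ×-congʳ m (trans (+-identityˡ _) (*-identityʳ _)) ⟨
    m × (0# + g 0 * 1#)   ∎
  linear-recurrence-solution x m g B B₀≈0 rec (suc i) = begin
    B (suc (suc i))                ≈⟨ rec (suc i) ⟩
    x * B (suc i) + m × g (suc i)  ≈⟨ +-congʳ (*-congˡ (linear-recurrence-solution x m g B B₀≈0 rec i)) ⟩
    x * (m × S) + m × g (suc i)    ≈⟨ +-congʳ (×-comm-* m x S) ⟩
    m × (x * S) + m × g (suc i)    ≈⟨ ×-distrib-+ _ _ m ⟨
    m × (x * S + g (suc i))        ≈⟨ ×-congʳ m (sumBelow-weighted-powers-suc x g i) ⟨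
    m × sumBelow (suc (suc i)) (λ r → g r * x ^ (suc i ∸ r))  ∎
    where S = sumBelow (suc i) (λ r → g r * x ^ (i ∸ r))

  nat-suc-+ : ∀ s x → nat (suc s) + x ≈ nat s + (x + 1#)
  nat-suc-+ s x = solve 3 (λ o n x → (o :+ n) :+ x := n :+ (x :+ o)) refl 1# (nat s) x

  b-forward-difference : ∀ i j k → b i (suc j) k ≈ b i j (k + 1#) - b i j k
  b-forward-difference i j k = begin
    b i (suc j) k
      ≈⟨ sumBelow-pascal j g ⟩
    sumBelow (suc j) (λ s → (j C s) × g (suc s)) + sumBelow (suc j) (λ t → (j C t) × g t)
      ≈⟨ +-cong (sumBelow-cong (suc j) (λ s _ → ×-congʳ (j C s) (*-congˡ (^-congˡ i (nat-suc-+ s k)))))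
                (trans (sumBelow-cong (suc j) flip-sign) (sym (-‿distrib-sumBelow (suc j) _))) ⟩
    b i j (k + 1#) - b i j k
      ∎
    where
    g : ℕ → Carrier
    g t = (- 1#) ^ (suc j ∸ t) * (nat t + k) ^ i
    flip-sign : ∀ t → t < suc j → (j C t) × g t ≈ - ((j C t) × ((- 1#) ^ (j ∸ t) * (nat t + k) ^ i))
    flip-sign t (s≤s t≤j) = begin
      (j C t) × ((- 1#) ^ (suc j ∸ t) * q)
        ≈⟨ ×-congʳ (j C t) (*-congʳ (^-congʳ (- 1#) (ℕ.+-∸-assoc 1 t≤j))) ⟩
      (j C t) × ((- 1#) * (- 1#) ^ (j ∸ t) * q)
        ≈⟨ ×-congʳ (j C t) (*-congʳ (-1*x≈-x _)) ⟩
      (j C t) × (- (- 1#) ^ (j ∸ t) * q)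
        ≈⟨ ×-congʳ (j C t) (-‿distribˡ-* _ q) ⟨
      (j C t) × - ((- 1#) ^ (j ∸ t) * q)
        ≈⟨ ×≈nat* (j C t) _ ⟩
      nat (j C t) * - ((- 1#) ^ (j ∸ t) * q)
        ≈⟨ -‿distribʳ-* (nat (j C t)) _ ⟨
      - (nat (j C t) * ((- 1#) ^ (j ∸ t) * q))
        ≈⟨ -‿cong (×≈nat* (j C t) _) ⟨
      - ((j C t) × ((- 1#) ^ (j ∸ t) * q))
        ∎
      where q = (nat t + k) ^ i

  b-shift-expansion : ∀ i j k → b i j (k + 1#) ≈ sumBelow (suc i) (λ r → (i C r) × b r j k)
  b-shift-expansion i j k = begin
    sumBelow (suc j) (λ t → (j C t) × ((- 1#) ^ (j ∸ t) * (nat t + (k + 1#)) ^ i))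
      ≈⟨ sumBelow-cong (suc j) (λ t _ → ×-congʳ (j C t) (*-congˡ (expand t))) ⟩
    sumBelow (suc j) (λ t → (j C t) × ((- 1#) ^ (j ∸ t) * sumBelow (suc i) (λ r → (i C r) × (nat t + k) ^ r)))
      ≈⟨ sumBelow-cong (suc j) (λ t _ → distribute t) ⟩
    sumBelow (suc j) (λ t → sumBelow (suc i) (λ r → (i C r) × term r t))
      ≈⟨ sumBelow-comm (suc j) (suc i) _ ⟩
    sumBelow (suc i) (λ r → sumBelow (suc j) (λ t → (i C r) × term r t))
      ≈⟨ sumBelow-cong (suc i) (λ r _ → ×-distribˡ-sumBelow (i C r) (suc j) (term r)) ⟨
    sumBelow (suc i) (λ r → (i C r) × b r j k)
      ∎
    where
    term : ℕ → ℕ → Carrier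
    term r t = (j C t) × ((- 1#) ^ (j ∸ t) * (nat t + k) ^ r)
    expand : ∀ t → (nat t + (k + 1#)) ^ i ≈ sumBelow (suc i) (λ r → (i C r) × (nat t + k) ^ r)
    expand t = trans (^-congˡ i (sym (+-assoc _ _ _))) (binomial-expansion i (nat t + k))
    swap-× : ∀ m n x → m × (n × x) ≈ n × (m × x)
    swap-× m n x = trans (×-assocˡ x m n) (trans (reflexive (≡.cong (_× x) (ℕ.*-comm m n))) (sym (×-assocˡ x n m)))
    distribute : ∀ t → (j C t) × ((- 1#) ^ (j ∸ t) * sumBelow (suc i) (λ r → (i C r) × (nat t + k) ^ r))
                       ≈ sumBelow (suc i) (λ r → (i C r) × term r t)
    distribute t = begin
      (j C t) × ((- 1#) ^ (j ∸ t) * sumBelow (suc i) (λ r → (i C r) × (nat t + k) ^ r))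
        ≈⟨ ×-congʳ (j C t) (*-distribˡ-sumBelow (suc i) _ _) ⟩
      (j C t) × sumBelow (suc i) (λ r → (- 1#) ^ (j ∸ t) * ((i C r) × (nat t + k) ^ r))
        ≈⟨ ×-distribˡ-sumBelow (j C t) (suc i) _ ⟩
      sumBelow (suc i) (λ r → (j C t) × ((- 1#) ^ (j ∸ t) * ((i C r) × (nat t + k) ^ r)))
        ≈⟨ sumBelow-cong (suc i) (λ r _ → trans (×-congʳ (j C t) (×-comm-* (i C r) _ _)) (swap-× (j C t) (i C r) _)) ⟩
      sumBelow (suc i) (λ r → (i C r) × term r t)
        ∎

  b-suc-suc : ∀ i j k → b (suc i) (suc j) k ≈ k * b i (suc j) k + suc j × b i j (k + 1#)
  b-suc-suc i j k = begin
    b (suc i) (suc j) k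
      ≈⟨ sumBelow-cong (suc (suc j)) (λ t _ → split t) ⟩
    sumBelow (suc (suc j)) (λ t → k * T t + U t)
      ≈⟨ sumBelow-+ (suc (suc j)) _ _ ⟩
    sumBelow (suc (suc j)) (λ t → k * T t) + sumBelow (suc (suc j)) U
      ≈⟨ +-congʳ (*-distribˡ-sumBelow (suc (suc j)) k T) ⟨
    k * b i (suc j) k + sumBelow (suc (suc j)) U
      ≈⟨ +-congˡ (sumBelow-head (suc j) U) ⟩
    k * b i (suc j) k + (U 0 + sumBelow (suc j) (λ s → U (suc s)))
      ≈⟨ +-congˡ (+-cong U₀≈0 (sumBelow-cong (suc j) (λ s _ → absorb s))) ⟩
    k * b i (suc j) k + (0# + sumBelow (suc j) (λ s → suc j × b-term s))
      ≈⟨ +-congˡ (trans (+-identityˡ _) (sym (×-distribˡ-sumBelow (suc j) (suc j) b-term))) ⟩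
    k * b i (suc j) k + suc j × b i j (k + 1#)
      ∎
    where
    T U : ℕ → Carrier
    T t = (suc j C t) × ((- 1#) ^ (suc j ∸ t) * (nat t + k) ^ i)
    U t = (suc j C t) × ((- 1#) ^ (suc j ∸ t) * (nat t * (nat t + k) ^ i))
    b-term : ℕ → Carrier
    b-term s = (j C s) × ((- 1#) ^ (j ∸ s) * (nat s + (k + 1#)) ^ i)
    split : ∀ t → (suc j C t) × ((- 1#) ^ (suc j ∸ t) * ((nat t + k) * (nat t + k) ^ i)) ≈ k * T t + U t
    split t = begin
      (suc j C t) × (σ * ((nat t + k) * q))
        ≈⟨ ×-congʳ (suc j C t)
             (solve 4 (λ σ n k q → σ :* ((n :+ k) :* q) := k :* (σ :* q) :+ σ :* (n :* q)) refl σ (nat t) k q) ⟩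
      (suc j C t) × (k * (σ * q) + σ * (nat t * q))
        ≈⟨ ×-distrib-+ _ _ (suc j C t) ⟩
      (suc j C t) × (k * (σ * q)) + U t
        ≈⟨ +-congʳ (×-comm-* (suc j C t) k _) ⟨
      k * T t + U t
        ∎
      where
      σ = (- 1#) ^ (suc j ∸ t)
      q = (nat t + k) ^ i
    U₀≈0 : U 0 ≈ 0#
    U₀≈0 = trans (×-congʳ (suc j C 0) (trans (*-congˡ (zeroˡ _)) (zeroʳ _))) (×-zeroʳ (suc j C 0))
    absorb : ∀ s → U (suc s) ≈ suc j × b-term s
    absorb s = begin
      (suc j C suc s) × (σ * (nat (suc s) * q))
        ≈⟨ ×-congʳ (suc j C suc s) (solve 3 (λ σ n q → σ :* (n :* q) := n :* (σ :* q)) refl σ (nat (suc s)) q) ⟩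
      (suc j C suc s) × (nat (suc s) * (σ * q))
        ≈⟨ ×-congʳ (suc j C suc s) (sym (×≈nat* (suc s) _)) ⟩
      (suc j C suc s) × (suc s × (σ * q))
        ≈⟨ ×-assocˡ _ (suc j C suc s) (suc s) ⟩
      ((suc j C suc s) ℕ.* suc s) × (σ * q)
        ≈⟨ reflexive (≡.cong (_× (σ * q))
             (≡.trans (ℕ.*-comm (suc j C suc s) (suc s)) ([1+k]*[1+n]C[1+k]≡[1+n]*nCk j s))) ⟩
      (suc j ℕ.* (j C s)) × (σ * q)
        ≈⟨ ×-assocˡ _ (suc j) (j C s) ⟨
      suc j × ((j C s) × (σ * q))
        ≈⟨ ×-congʳ (suc j) (×-congʳ (j C s) (*-congˡ (^-congˡ i (nat-suc-+ s k)))) ⟩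
      suc j × b-term s
        ∎
      where
      σ = (- 1#) ^ (j ∸ s)
      q = (nat (suc s) + k) ^ i

  b-difference-expansion : ∀ i j k → b i (suc j) k ≈ sumBelow i (λ r → (i C r) × b r j k)
  b-difference-expansion i j k = begin
    b i (suc j) k
      ≈⟨ b-forward-difference i j k ⟩
    b i j (k + 1#) - b i j k
      ≈⟨ +-congʳ (b-shift-expansion i j k) ⟩
    (S + (i C i) × b i j k) - b i j k
      ≈⟨ +-congʳ (+-congˡ (trans (reflexive (≡.cong (_× b i j k) (nCn≡1 i))) (×-homo-1 (b i j k)))) ⟩
    (S + b i j k) - b i j k
      ≈⟨ +-assoc _ _ _ ⟩
    S + (b i j k - b i j k)
      ≈⟨ +-congˡ (-‿inverseʳ _) ⟩
    S + 0#
      ≈⟨ +-identityʳ S ⟩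
    S
      ∎
    where S = sumBelow i (λ r → (i C r) × b r j k)

  b-vanishes-below : ∀ j r k → r < j → b r j k ≈ 0#
  b-vanishes-below (suc j) r k r<1+j = trans (b-difference-expansion r j k)
    (sumBelow-zero r (λ s s<r → trans (×-congʳ (r C s) (b-vanishes-below j s k (ℕ.<-≤-trans s<r (s≤s⁻¹ r<1+j))))
                                      (×-zeroʳ (r C s))))

  sumBelow≈sumFromTo-b* : ∀ i j k (w : ℕ → Carrier) →
    sumBelow (suc i) (λ r → b r j k * w r) ≈ sumFromTo j i (λ r → b r j k * w r)
  sumBelow≈sumFromTo-b* i j k w =
    sumBelow≈sumFromTo j i _ (λ r r<j → trans (*-congʳ (b-vanishes-below j r k r<j)) (zeroˡ (w r)))

  b-suc-suc-expansion : ∀ i j k →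
    b (suc i) (suc j) k ≈ suc j × sumBelow (suc i) (λ r → (i C r) × b r j k) + k * b i (suc j) k
  b-suc-suc-expansion i j k =
    trans (b-suc-suc i j k) (trans (+-comm _ _) (+-congʳ (×-congʳ (suc j) (b-shift-expansion i j k))))

  b-suc-suc-at-k : ∀ i j k → b (suc i) (suc j) k ≈ (nat j + k + 1#) * b i (suc j) k + suc j × b i j k
  b-suc-suc-at-k i j k = begin
    b (suc i) (suc j) k
      ≈⟨ b-suc-suc i j k ⟩
    k * B + suc j × b i j (k + 1#)
      ≈⟨ +-congˡ (×-congʳ (suc j) shift≈B+b) ⟩
    k * B + suc j × (B + b i j k)
      ≈⟨ +-congˡ (×≈nat* (suc j) _) ⟩
    k * B + nat (suc j) * (B + b i j k)
      ≈⟨ solve 5 (λ o n k B g → k :* B :+ (o :+ n) :* (B :+ g) := (n :+ k :+ o) :* B :+ (o :+ n) :* g)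
               refl 1# (nat j) k B (b i j k) ⟩
    (nat j + k + 1#) * B + nat (suc j) * b i j k
      ≈⟨ +-congˡ (×≈nat* (suc j) _) ⟨
    (nat j + k + 1#) * B + suc j × b i j k
      ∎
    where
    B = b i (suc j) k
    shift≈B+b : b i j (k + 1#) ≈ B + b i j k
    shift≈B+b = sym (begin
      B + b i j k                           ≈⟨ +-congʳ (b-forward-difference i j k) ⟩
      b i j (k + 1#) - b i j k + b i j k    ≈⟨ +-assoc _ _ _ ⟩
      b i j (k + 1#) + (- b i j k + b i j k) ≈⟨ +-congˡ (-‿inverseˡ _) ⟩
      b i j (k + 1#) + 0#                   ≈⟨ +-identityʳ _ ⟩
      b i j (k + 1#)                        ∎)

  b-suc-suc-unrolled : ∀ i j k →
    b (suc i) (suc j) k ≈ suc j × sumFromTo j i (λ r → b r j k * (nat j + k + 1#) ^ (i ∸ r))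
  b-suc-suc-unrolled i j k =
    trans (linear-recurrence-solution (nat j + k + 1#) (suc j) (λ r → b r j k) (λ i → b i (suc j) k)
             (b-difference-expansion 0 j k) (λ i → b-suc-suc-at-k i j k) i)
          (×-congʳ (suc j) (sumBelow≈sumFromTo-b* i j k _))

  b-suc-suc-unrolled-shifted : ∀ i j k →
    b (suc i) (suc j) k ≈ suc j × sumFromTo j i (λ r → b r j (k + 1#) * k ^ (i ∸ r))
  b-suc-suc-unrolled-shifted i j k =
    trans (linear-recurrence-solution k (suc j) (λ r → b r j (k + 1#)) (λ i → b i (suc j) k)
             (b-difference-expansion 0 j k) (λ i → b-suc-suc i j k) i)
          (×-congʳ (suc j) (sumBelow≈sumFromTo-b* i j (k + 1#) _))

mainTheorem7 : ∀ {c ℓ : Level} (R : CommutativeRing c ℓ) →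
    let open CommutativeRing R
        open BNum R
    in
    ∀ (i j : ℕ) (k : Carrier) →
      (b i (suc j) k ≈ sumBelow i (λ r → (i C r) × b r j k))
      ∧ (b i j (k + 1#) ≈ sumBelow (suc i) (λ r → (i C r) × b r j k))
      ∧ (b (suc i) (suc j) k ≈ (suc j) × sumBelow (suc i) (λ r → (i C r) × b r j k) + k * b i (suc j) k)
      ∧ (b (suc i) (suc j) k ≈ (suc j) × sumFromTo j i (λ r → b r j k * ((nat j + k + 1#) ^ (i ∸ r))))
      ∧ (b (suc i) (suc j) k ≈ (suc j) × sumFromTo j i (λ r → b r j (k + 1#) * (k ^ (i ∸ r))))
mainTheorem7 R i j k =
    b-difference-expansion i j k
  , b-shift-expansion i j k
  , b-suc-suc-expansion i j k
  , b-suc-suc-unrolled i j k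
  , b-suc-suc-unrolled-shifted i j k
  where open ForwardDifferences R
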